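{- The formula $\lnot\top^*\to(\lnot\top^* * \lnot\top^*)$ is provable in $LS_{PASL}+S$.
   Context: Formulae: built from propositional variables and constants $\top,\bot,\top^*$ using $\land,\to,*,-\!*$; $\lnot A$ abbreviates $A\to\bot$. Labels: countably infinite set $\mathcal{L}$ with distinguished $\epsilon$. Relational atoms: $(a,b\triangleright c)$, $a=b$, $a\neq b$. Sequents $\mathcal{G};\Gamma\vdash\Delta$: finite set $\mathcal{G}$ of relational atoms, finite sets $\Gamma,\Delta$ of labelled formulae $a:A$. $E(\mathcal{G})\vdash a=b$ iff $(a,b)$ is in the smallest equivalence relation on $\mathcal{L}$ containing all $(c,d)$ with $c=d\in\mathcal{G}$. $LS$ (no cut): $(id)$ $\mathcal{G};\Gamma,a:p\vdash b:p,\Delta$ if $E(\mathcal{G})\vdash a=b$; $(\bot L)$; $(\top R)$; $(\top^*R)$ $\mathcal{G};\Gamma\vdash a:\top^*,\Delta$ if $E(\mathcal{G})\vdash a=\epsilon$; $(NEq)$ closes $\mathcal{G};\Gamma\vdash\Delta$ if $a\neq b\in\mathcal{G}$ and $E(\mathcal{G})\vdash a=b$; $(\top^*L)$ from $\mathcal{G}\cup\{a=\epsilon\};\Gamma\vdash\Delta$ infer $\mathcal{G};\Gamma,a:\top^*\vdash\Delta$; standard $\land L,\land R,\to L,\to R$ at one label; $(*L)$ from $\mathcal{G}\cup\{(x,y\triangleright z)\};\Gamma,x:A,y:B\vdash\Delta$ infer $\mathcal{G};\Gamma,z:A*B\vdash\Delta$ ($x,y$ fresh); $(-\!*R)$ from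 $\mathcal{G}\cup\{(x,z\triangleright y)\};\Gamma,x:A\vdash y:B,\Delta$ infer $\mathcal{G};\Gamma\vdash z:A-\!*B,\Delta$ ($x,y$ fresh); $(*R)$ if $(x,y\triangleright z)\in\mathcal{G}$ and $E(\mathcal{G})\vdash z=w$, from $\mathcal{G};\Gamma\vdash x:A,w:A*B,\Delta$ and $\mathcal{G};\Gamma\vdash y:B,w:A*B,\Delta$ infer $\mathcal{G};\Gamma\vdash w:A*B,\Delta$; $(-\!*L)$ if $(x,w\triangleright y)\in\mathcal{G}$ and $E(\mathcal{G})\vdash z=w$, from $\mathcal{G};\Gamma,z:A-\!*B\vdash x:A,\Delta$ and $\mathcal{G};\Gamma,z:A-\!*B,y:B\vdash\Delta$ infer $\mathcal{G};\Gamma,z:A-\!*B\vdash\Delta$; $(EM)$ from $\mathcal{G}\cup\{a=b\};\Gamma\vdash\Delta$ and $\mathcal{G}\cup\{a\neq b\};\Gamma\vdash\Delta$ infer $\mathcal{G};\Gamma\vdash\Delta$. A frame axiom $\forall\vec x.(s_1=t_1\&\cdots\& s_p=t_p\& S_1\&\cdots\& S_k\Rightarrow\exists y_1..y_n.(T_1\&\cdots\& T_l))$ gives the structural rule: for a substitution $\theta$ of labels for $\vec x$ (fixing $\epsilon$) with each $S_i\theta\in\mathcal{G}$ and $E(\mathcal{G})\vdash s_i\theta=t_i\theta$, and distinct fresh labels $b_j\neq\epsilon$ with $\sigma=[b_j/y_j]$: from $\mathcal{G}\cup\{T_i\theta\sigma\}_i;\Gamma\vdash\Delta$ infer $\mathcal{G};\Gamma\vdash\Delta$.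 $LS_{PASL}$ = $LS$ plus rules for: (E) $y=\epsilon\&(x,y\triangleright z)\Rightarrow x=z$; (U) $(x,\epsilon\triangleright x)$; (Com) $(x,y\triangleright z)\Rightarrow(y,x\triangleright z)$; (A) $y=y'\&(u,y\triangleright x)\&(v,w\triangleright y')\Rightarrow\exists z.((z,w\triangleright x)\&(u,v\triangleright z))$; (P) $w=w'\&x=x'\&(w,x\triangleright y)\&(w',x'\triangleright z)\Rightarrow y=z$; (C) $x=x'\&z=z'\&(x,y\triangleright z)\&(x',w\triangleright z')\Rightarrow y=w$ (all variables universally quantified). $S$ is the rule synthesised from splittability $\forall h_0.\ h_0\neq\epsilon\Rightarrow\exists h_1,h_2.(h_1\neq\epsilon\ \&\ h_2\neq\epsilon\ \&\ (h_1,h_2\triangleright h_0))$, i.e. from $\mathcal{G}\cup\{z\neq\epsilon,(x,y\triangleright z),x\neq\epsilon,y\neq\epsilon\};\Gamma\vdash\Delta$ infer $\mathcal{G}\cup\{z\neq\epsilon\};\Gamma\vdash\Delta$, where $x,y$ do not occur in the conclusion. A formula $F$ is provable if $\emptyset;\emptyset\vdash w:F$ has a finite derivation for a label $w\neq\epsilon$. -}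

module Defs where

open import Data.Nat using (ℕ)
open import Data.List using (List; []; _∷_; _++_; concatMap)
open import Data.List.Membership.Propositional using (_∈_; _∉_)
open import Data.Product using (_×_; Σ; ∃; _,_)
open import Relation.Binary.PropositionalEquality using (_≡_; _≢_)
open import Relation.Nullary using (¬_)

data Form : Set where
  var   : ℕ → Form
  ⊤′    : Form
  ⊥′    : Form
  ⊤*    : Form
  _∧′_  : Form → Form → Form
  _⇒_   : Form → Form → Form
  _✱_   : Form → Form → Form
  _-✱_  : Form → Form → Form

infixr 6 _∧′_
infixr 5 _✱_
infixr 4 _-✱_
infixr 3 _⇒_

¬′_ : Form → Form
¬′ A = A ⇒ ⊥′

Label : Set
Label = ℕ

ε : Label
ε = 0

-- relational atoms (a,b ▷ c), a = b, a ≠ b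
data RAtom : Set where
  tri : Label → Label → Label → RAtom
  eq  : Label → Label → RAtom
  neq : Label → Label → RAtom

record LF : Set where
  constructor _∶_
  field
    lab  : Label
    form : Form

infix 2 _∶_

-- Finite sets are represented by lists, considered up to having the same
-- elements (see the rule `set-eq` below).
_≈ˢ_ : {A : Set} → List A → List A → Set
l ≈ˢ l′ = ∀ x → (x ∈ l → x ∈ l′) × (x ∈ l′ → x ∈ l)

data _⊢E_≐_ (G : List RAtom) : Label → Label → Set where
  base  : ∀ {a b} → eq a b ∈ G → G ⊢E a ≐ b
  refl′ : ∀ {a} → G ⊢E a ≐ a
  sym′  : ∀ {a b} → G ⊢E a ≐ b → G ⊢E b ≐ a
  trans′ : ∀ {a b c} → G ⊢E a ≐ b → G ⊢E b ≐ c → G ⊢E a ≐ c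

-- Labels occurring in a sequent (ε is always considered to occur, so that
-- fresh labels are always distinct from ε).

labelsR : RAtom → List Label
labelsR (tri a b c) = a ∷ b ∷ c ∷ []
labelsR (eq a b)    = a ∷ b ∷ []
labelsR (neq a b)   = a ∷ b ∷ []

labelsF : LF → List Label
labelsF (a ∶ _) = a ∷ []

labels : List RAtom → List LF → List LF → List Label
labels G Γ Δ = ε ∷ (concatMap labelsR G ++ concatMap labelsF Γ ++ concatMap labelsF Δ)

Fresh : Label → List RAtom → List LF → List LF → Set
Fresh x G Γ Δ = x ∉ labels G Γ Δ

-- Derivability in LS_PASL + S :   Der G Γ Δ   means   G ; Γ ⊢ Δ
-- has a (finite) derivation.

data Der : List RAtom → List LF → List LF → Set where

  set-eq : ∀ {G G′ Γ Γ′ Δ Δ′} → G ≈ˢ G′ → Γ ≈ˢ Γ′ → Δ ≈ˢ Δ′ →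
           Der G Γ Δ → Der G′ Γ′ Δ′

  id    : ∀ {G Γ Δ a b p} → G ⊢E a ≐ b →
          Der G ((a ∶ var p) ∷ Γ) ((b ∶ var p) ∷ Δ)
  ⊥L    : ∀ {G Γ Δ a} → Der G ((a ∶ ⊥′) ∷ Γ) Δ
  ⊤R    : ∀ {G Γ Δ a} → Der G Γ ((a ∶ ⊤′) ∷ Δ)
  ⊤*R   : ∀ {G Γ Δ a} → G ⊢E a ≐ ε → Der G Γ ((a ∶ ⊤*) ∷ Δ)
  NEq   : ∀ {G Γ Δ a b} → neq a b ∈ G → G ⊢E a ≐ b → Der G Γ Δ
  ⊤*L   : ∀ {G Γ Δ a} → Der (eq a ε ∷ G) Γ Δ → Der G ((a ∶ ⊤*) ∷ Γ) Δ
  ∧L    : ∀ {G Γ Δ a A B} → Der G ((a ∶ A) ∷ (a ∶ B) ∷ Γ) Δ →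
          Der G ((a ∶ A ∧′ B) ∷ Γ) Δ
  ∧R    : ∀ {G Γ Δ a A B} → Der G Γ ((a ∶ A) ∷ Δ) → Der G Γ ((a ∶ B) ∷ Δ) →
          Der G Γ ((a ∶ A ∧′ B) ∷ Δ)
  ⇒L    : ∀ {G Γ Δ a A B} → Der G Γ ((a ∶ A) ∷ Δ) → Der G ((a ∶ B) ∷ Γ) Δ →
          Der G ((a ∶ A ⇒ B) ∷ Γ) Δ
  ⇒R    : ∀ {G Γ Δ a A B} → Der G ((a ∶ A) ∷ Γ) ((a ∶ B) ∷ Δ) →
          Der G Γ ((a ∶ A ⇒ B) ∷ Δ)
  ✱L    : ∀ {G Γ Δ x y z A B} →
          Fresh x G ((z ∶ A ✱ B) ∷ Γ) Δ → Fresh y G ((z ∶ A ✱ B) ∷ Γ) Δ → x ≢ y →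
          Der (tri x y z ∷ G) ((x ∶ A) ∷ (y ∶ B) ∷ Γ) Δ →
          Der G ((z ∶ A ✱ B) ∷ Γ) Δ
  -✱R   : ∀ {G Γ Δ x y z A B} →
          Fresh x G Γ ((z ∶ A -✱ B) ∷ Δ) → Fresh y G Γ ((z ∶ A -✱ B) ∷ Δ) → x ≢ y →
          Der (tri x z y ∷ G) ((x ∶ A) ∷ Γ) ((y ∶ B) ∷ Δ) →
          Der G Γ ((z ∶ A -✱ B) ∷ Δ)
  ✱R    : ∀ {G Γ Δ x y z w A B} → tri x y z ∈ G → G ⊢E z ≐ w →
          Der G Γ ((x ∶ A) ∷ (w ∶ A ✱ B) ∷ Δ) →
          Der G Γ ((y ∶ B) ∷ (w ∶ A ✱ B) ∷ Δ) →
          Der G Γ ((w ∶ A ✱ B) ∷ Δ)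
  -✱L   : ∀ {G Γ Δ x y z w A B} → tri x w y ∈ G → G ⊢E z ≐ w →
          Der G ((z ∶ A -✱ B) ∷ Γ) ((x ∶ A) ∷ Δ) →
          Der G ((z ∶ A -✱ B) ∷ (y ∶ B) ∷ Γ) Δ →
          Der G ((z ∶ A -✱ B) ∷ Γ) Δ
  EM    : ∀ {G Γ Δ a b} → Der (eq a b ∷ G) Γ Δ → Der (neq a b ∷ G) Γ Δ →
          Der G Γ Δ

  E     : ∀ {G Γ Δ x y z} → G ⊢E y ≐ ε → tri x y z ∈ G →
          Der (eq x z ∷ G) Γ Δ → Der G Γ Δ
  U     : ∀ {G Γ Δ x} → Der (tri x ε x ∷ G) Γ Δ → Der G Γ Δ
  Com   : ∀ {G Γ Δ x y z} → tri x y z ∈ G →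
          Der (tri y x z ∷ G) Γ Δ → Der G Γ Δ
  A     : ∀ {G Γ Δ u v w x y y′ z} → G ⊢E y ≐ y′ →
          tri u y x ∈ G → tri v w y′ ∈ G → Fresh z G Γ Δ →
          Der (tri z w x ∷ tri u v z ∷ G) Γ Δ → Der G Γ Δ
  P     : ∀ {G Γ Δ w w′ x x′ y z} → G ⊢E w ≐ w′ → G ⊢E x ≐ x′ →
          tri w x y ∈ G → tri w′ x′ z ∈ G →
          Der (eq y z ∷ G) Γ Δ → Der G Γ Δ
  C     : ∀ {G Γ Δ x x′ y z z′ w} → G ⊢E x ≐ x′ → G ⊢E z ≐ z′ →
          tri x y z ∈ G → tri x′ w z′ ∈ G →
          Der (eq y w ∷ G) Γ Δ → Der G Γ Δ

  S     : ∀ {G Γ Δ x y z} →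
          Fresh x (neq z ε ∷ G) Γ Δ → Fresh y (neq z ε ∷ G) Γ Δ → x ≢ y →
          Der (neq z ε ∷ tri x y z ∷ neq x ε ∷ neq y ε ∷ G) Γ Δ →
          Der (neq z ε ∷ G) Γ Δ

Provable : Form → Set
Provable F = Σ Label (λ w → w ≢ ε × Der [] [] ((w ∶ F) ∷ []))

module Submission where

-- Its derivation in LS_PASL + S is a case split (EM) on
-- whether the world w = 1 at which it is evaluated equals ε.
--
--  * If w = ε, the hypothesis ¬⊤* at w is contradictory: ⊤* holds at any
--    label provably equal to ε (lemma notUnit-at-unit).
--  * If w ≠ ε, the splittability rule S yields fresh x, y ≠ ε with
--    (x, y ▷ w); rule ✱R with this triple reduces the goal to ¬⊤* at x and
--    at y, and ¬⊤* holds at every label recorded as distinct from ε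
--    (lemma notUnit-at-nonunit).

open import Defs
open import Data.Nat using (_≟_)
open import Data.List using (List; []; _∷_)
open import Data.List.Membership.Propositional using (_∈_)
open import Data.List.Membership.DecPropositional _≟_ using (_∈?_)
open import Data.List.Relation.Unary.Any using (here; there)
open import Data.Product using (_,_)
open import Relation.Nullary.Decidable using (toWitnessFalse)
open import Relation.Binary.PropositionalEquality using (refl)

notUnit-at-unit : ∀ {G Γ Δ a} → G ⊢E a ≐ ε → Der G ((a ∶ ¬′ ⊤*) ∷ Γ) Δ
notUnit-at-unit a≐ε = ⇒L (⊤*R a≐ε) ⊥L

notUnit-at-nonunit : ∀ {G Γ Δ a} → neq a ε ∈ G → Der G Γ ((a ∶ ¬′ ⊤*) ∷ Δ)
notUnit-at-nonunit a≢ε = ⇒R (⊤*L (NEq (there a≢ε) (base (here refl))))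

-- The sequent after ⇒R, at the world 1 of the final proof.
Γ₁ : List LF
Γ₁ = (1 ∶ ¬′ ⊤*) ∷ []

Δ₁ : List LF
Δ₁ = (1 ∶ (¬′ ⊤*) ✱ (¬′ ⊤*)) ∷ []

unit-case : Der (eq 1 ε ∷ []) Γ₁ Δ₁
unit-case = notUnit-at-unit (base (here refl))

nonunit-case : Der (neq 1 ε ∷ []) Γ₁ Δ₁
nonunit-case =
  S {x = 2} {y = 3} (toWitnessFalse {a? = 2 ∈? _} _) (toWitnessFalse {a? = 3 ∈? _} _) (λ ())
    (✱R 2,3▷1 refl′
      (notUnit-at-nonunit (there (there (here refl))))
      (notUnit-at-nonunit (there (there (there (here refl))))))
  where
  2,3▷1 : tri 2 3 1 ∈ (neq 1 ε ∷ tri 2 3 1 ∷ neq 2 ε ∷ neq 3 ε ∷ [])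
  2,3▷1 = there (here refl)

proposition4p5 : Provable ((¬′ ⊤*) ⇒ ((¬′ ⊤*) ✱ (¬′ ⊤*)))
proposition4p5 = 1 , (λ ()) , ⇒R (EM {a = 1} {b = ε} unit-case nonunit-case)
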